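{- For every integer $n \geq 7$, the $n$-gear graph $G_n$ satisfies $rn(G_n) \leq 4n+2$.
   Context: All graphs are simple and connected; $d(u,v)$ is the graph distance and $\operatorname{diam}(G)$ the diameter. A radio labeling of $G$ is a one-to-one map $c: V(G) \to \mathbb{Z}_{+}$ (positive integers) such that $d(u,v) + |c(u)-c(v)| \geq \operatorname{diam}(G)+1$ for all distinct $u,v \in V(G)$. The span of $c$ is the maximum value of $c$; the radio number $rn(G)$ is the minimum span over all radio labelings of $G$. The $n$-gear $G_n$ is the graph consisting of a cycle on $2n$ vertices together with an additional center vertex adjacent to every other vertex of the cycle; it has $2n+1$ vertices and $3n$ edges. -}

module Defs where

open import Data.Nat using (ℕ; zero; suc; _+_; _*_; _≤_; ∣_-_∣)
open import Data.Fin using (Fin; toℕ) renaming (zero to fzero; suc to fsuc)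
open import Data.Product using (Σ; ∃; _×_; _,_)
open import Data.Sum using (_⊎_)
open import Data.Empty using (⊥)
open import Relation.Binary.PropositionalEquality using (_≡_; _≢_)
open import Function.Definitions using (Injective)

data Walk {N : ℕ} (Adj : Fin N → Fin N → Set) : Fin N → Fin N → ℕ → Set where
  nil  : ∀ {u} → Walk Adj u u 0
  cons : ∀ {u w v k} → Adj u w → Walk Adj w v k → Walk Adj u v (suc k)

IsDist : {N : ℕ} (Adj : Fin N → Fin N → Set) → Fin N → Fin N → ℕ → Set
IsDist Adj u v k = Walk Adj u v k × (∀ m → Walk Adj u v m → k ≤ m)

IsDiam : {N : ℕ} (Adj : Fin N → Fin N → Set) → ℕ → Set
IsDiam Adj D =
  (∀ u v → Σ ℕ λ k → IsDist Adj u v k × k ≤ D) ×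
  Σ _ λ u → Σ _ λ v → IsDist Adj u v D

IsRadioLabeling : {N : ℕ} (Adj : Fin N → Fin N → Set) → ℕ → (Fin N → ℕ) → Set
IsRadioLabeling Adj D c =
  Injective _≡_ _≡_ c ×
  (∀ v → 1 ≤ c v) ×
  (∀ u v → u ≢ v → ∀ k → IsDist Adj u v k → suc D ≤ k + ∣ c u - c v ∣)

RadioNumberAtMost : {N : ℕ} (Adj : Fin N → Fin N → Set) → ℕ → Set
RadioNumberAtMost {N} Adj m =
  Σ ℕ λ D → IsDiam Adj D ×
  Σ (Fin N → ℕ) λ c → IsRadioLabeling Adj D c × (∀ v → c v ≤ m)

-- Adjacency of the cycle C_{2n} on indices 0 .. 2n-1 (i ~ i+1 mod 2n).
CycleAdj : ℕ → ℕ → ℕ → Set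
CycleAdj n a b =
  suc a ≡ b ⊎ suc b ≡ a ⊎ (a ≡ 0 × suc b ≡ 2 * n) ⊎ (b ≡ 0 × suc a ≡ 2 * n)

-- The n-gear G_n: vertex fzero is the centre, vertex fsuc i is the i-th
-- vertex of the cycle C_{2n}; the centre is adjacent to the cycle vertices
-- of even index (every other vertex of the cycle).
GearAdj : (n : ℕ) → Fin (suc (2 * n)) → Fin (suc (2 * n)) → Set
GearAdj n fzero    fzero    = ⊥
GearAdj n fzero    (fsuc j) = Σ ℕ λ k → toℕ j ≡ 2 * k
GearAdj n (fsuc i) fzero    = Σ ℕ λ k → toℕ i ≡ 2 * k
GearAdj n (fsuc i) (fsuc j) = CycleAdj n (toℕ i) (toℕ j)

module Submission where

-- The gear G_n has diameter 4 and is bipartite: colour a cycle vertex by the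
-- parity of its index and the centre like the odd vertices.  In a properly
-- 2-coloured graph of diameter 4 the radio condition d(u,v) + |c u - c v| ≥ 5
-- reduces to three gap conditions: labels of adjacent vertices differ by at
-- least 4, labels of distinct vertices of equal colour by at least 3, labels
-- of distinct vertices by at least 2 (walks of length 0, 1, 2 and ≥ 3).
--
-- The centre gets label 1 and cycle vertex i gets label 4 + 2 σ(i), where σ is
-- the permutation of {0, …, 2n-1} sending odd i to i - 1 and even i to
-- i - 5 (mod 2n).  σ reverses parity, so equal-coloured cycle vertices get
-- σ-values of equal parity and hence σ-gap ≥ 2; consecutive cycle positions
-- get σ-gap ≥ 3; and σ(i) = 0 only for the odd index 1, which is not a spoke.

open import Defs
open import Data.Nat using (ℕ; zero; suc; _+_; _*_; _≤_; _<_; z≤n; s≤s; ∣_-_∣)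
open import Data.Nat.Properties
open import Data.Nat.Tactic.RingSolver using (solve-∀)
open import Data.Fin using (Fin; toℕ; fromℕ<) renaming (zero to fzero; suc to fsuc)
import Data.Fin.Properties as Fin
open import Data.Bool using (Bool; true; false; not; _xor_)
open import Data.Bool.Properties using (not-involutive; not-injective; not-¬; not-distribˡ-xor; not-distribʳ-xor)
open import Data.Product using (Σ; _×_; _,_; proj₁)
open import Data.Sum using (_⊎_; inj₁; inj₂)
open import Data.Empty using (⊥-elim)
open import Relation.Nullary using (Dec; yes; no; ¬_)
open import Relation.Nullary.Decidable using (_×-dec_; _⊎-dec_)
open import Relation.Binary.PropositionalEquality
open import Function using (_∘_)

-- Parity

parity : ℕ → Bool
parity zero = false
parity (suc x) = not (parity x)

double : ℕ → ℕ
double zero = zero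
double (suc m) = suc (suc (double m))

2*≡double : ∀ m → 2 * m ≡ double m
2*≡double zero = refl
2*≡double (suc m) = trans (*-suc 2 m) (cong (λ x → 2 + x) (2*≡double m))

parity-2+ : ∀ x → parity (2 + x) ≡ parity x
parity-2+ x = not-involutive (parity x)

-- σ is defined by cases on the first six positions and a shift beyond them.
parity-6+ : ∀ x → parity (6 + x) ≡ parity x
parity-6+ x = trans (parity-2+ (4 + x)) (trans (parity-2+ (2 + x)) (parity-2+ x))

parity-double : ∀ m → parity (double m) ≡ false
parity-double zero = refl
parity-double (suc m) = trans (parity-2+ (double m)) (parity-double m)

parity-2* : ∀ {x} k → x ≡ 2 * k → parity x ≡ false
parity-2* k refl = trans (cong parity (2*≡double k)) (parity-double k)

parity-even : ∀ x → parity x ≡ false → Σ ℕ λ k → x ≡ 2 * k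
parity-odd : ∀ x → parity x ≡ true → Σ ℕ λ k → x ≡ suc (2 * k)
parity-even zero _ = 0 , refl
parity-even (suc x) e with parity-odd x (not-injective e)
... | k , refl = suc k , sym (*-suc 2 k)
parity-odd zero ()
parity-odd (suc x) e with parity-even x (not-injective e)
... | k , refl = k , refl

gap-one-parity : ∀ a b → ∣ a - b ∣ ≡ 1 → parity a ≡ not (parity b)
gap-one-parity zero (suc zero) _ = refl
gap-one-parity (suc zero) zero _ = refl
gap-one-parity (suc a) (suc b) e = cong not (gap-one-parity a b e)

even? : ∀ x → Dec (Σ ℕ λ k → x ≡ 2 * k)
even? x with parity x in e
... | false = yes (parity-even x e)
... | true = no λ (k , x≡2k) → not-¬ refl (trans (sym e) (parity-2* k x≡2k))

-- Walks and distances in an arbitrary graph on Fin N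

_++ʷ_ : ∀ {N} {Adj : Fin N → Fin N → Set} {u v w k l} →
        Walk Adj u v k → Walk Adj v w l → Walk Adj u w (k + l)
nil ++ʷ q = q
cons a p ++ʷ q = cons a (p ++ʷ q)

least-witness : {P : ℕ → Set} → (∀ k → Dec (P k)) → ∀ L → P L →
                Σ ℕ λ k → (P k × (∀ m → P m → k ≤ m)) × k ≤ L
least-witness {P} P? L p with P? 0
... | yes p₀ = 0 , (p₀ , λ _ _ → z≤n) , z≤n
least-witness {P} P? zero p | no ¬p₀ = ⊥-elim (¬p₀ p)
least-witness {P} P? (suc L) p | no ¬p₀ with least-witness (λ k → P? (suc k)) L p
... | k , (pk , minimal) , k≤L = suc k , (pk , minimal′) , s≤s k≤L
  where
  minimal′ : ∀ m → P m → suc k ≤ m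
  minimal′ zero p₀ = ⊥-elim (¬p₀ p₀)
  minimal′ (suc m) pm = s≤s (minimal m pm)

module DecidableGraph {N : ℕ} {Adj : Fin N → Fin N → Set}
                      (adj? : ∀ u v → Dec (Adj u v)) where

  walk? : ∀ k u v → Dec (Walk Adj u v k)
  walk? zero u v with u Fin.≟ v
  ... | yes refl = yes nil
  ... | no u≢v = no λ { nil → u≢v refl }
  walk? (suc k) u v with Fin.any? (λ w → adj? u w ×-dec walk? k w v)
  ... | yes (w , a , p) = yes (cons a p)
  ... | no ¬step = no λ { (cons a p) → ¬step (_ , a , p) }

  distance≤ : ∀ {u v L} D → L ≤ D → Walk Adj u v L →
              Σ ℕ λ k → IsDist Adj u v k × k ≤ D
  distance≤ {u} {v} {L} D L≤D w with least-witness (λ k → walk? k u v) L w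
  ... | k , dist , k≤L = k , dist , ≤-trans k≤L L≤D

-- A labeling satisfying the radio inequality along every walk between
-- distinct vertices is a radio labeling, provided all distances are at most
-- D: distinct vertices with equal labels would violate the inequality.
radio-from-walks : ∀ {N} {Adj : Fin N → Fin N → Set} {D} (c : Fin N → ℕ) →
  (∀ u v → Σ ℕ λ k → IsDist Adj u v k × k ≤ D) →
  (∀ v → 1 ≤ c v) →
  (∀ {u v} → u ≢ v → ∀ {k} → Walk Adj u v k → suc D ≤ k + ∣ c u - c v ∣) →
  IsRadioLabeling Adj D c
radio-from-walks {Adj = Adj} {D} c distances positive radio =
  injective , positive , λ u v u≢v k dist → radio u≢v (proj₁ dist)
  where
  injective : ∀ {u v} → c u ≡ c v → u ≡ v
  injective {u} {v} cu≡cv with u Fin.≟ v | distances u v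
  ... | yes u≡v | _ = u≡v
  ... | no u≢v | k , (w , _) , k≤D = ⊥-elim (<⇒≱ (s≤s k≤D) (begin
    suc D                 ≤⟨ radio u≢v w ⟩
    k + ∣ c u - c v ∣     ≡⟨ cong (λ x → k + ∣ x - c v ∣) cu≡cv ⟩
    k + ∣ c v - c v ∣     ≡⟨ cong (k +_) (∣n-n∣≡0 (c v)) ⟩
    k + 0                 ≡⟨ +-identityʳ k ⟩
    k                     ∎))
    where open ≤-Reasoning

module TwoColoured {N : ℕ} {Adj : Fin N → Fin N → Set} (colour : Fin N → Bool)
                   (proper : ∀ {u v} → Adj u v → colour v ≡ not (colour u)) where

  walk-colour : ∀ {u v k} → Walk Adj u v k → colour v ≡ parity k xor colour u
  walk-colour nil = refl
  walk-colour {u} {v} {suc k} (cons {w = w} a p) = begin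
    colour v                     ≡⟨ walk-colour p ⟩
    parity k xor colour w        ≡⟨ cong (parity k xor_) (proper a) ⟩
    parity k xor not (colour u)  ≡⟨ not-distribʳ-xor (parity k) (colour u) ⟨
    not (parity k xor colour u)  ≡⟨ not-distribˡ-xor (parity k) (colour u) ⟩
    not (parity k) xor colour u  ∎
    where open ≡-Reasoning

  radio-diameter-4 : (c : Fin N → ℕ) →
    (∀ {u v} → u ≢ v → Adj u v → 4 ≤ ∣ c u - c v ∣) →
    (∀ {u v} → u ≢ v → colour u ≡ colour v → 3 ≤ ∣ c u - c v ∣) →
    (∀ {u v} → u ≢ v → 2 ≤ ∣ c u - c v ∣) →
    ∀ {u v} → u ≢ v → ∀ {k} → Walk Adj u v k → 5 ≤ k + ∣ c u - c v ∣
  radio-diameter-4 c adjacent-gap same-colour-gap distinct-gap u≢v nil = ⊥-elim (u≢v refl)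
  radio-diameter-4 c adjacent-gap same-colour-gap distinct-gap u≢v (cons a nil) =
    s≤s (adjacent-gap u≢v a)
  radio-diameter-4 c adjacent-gap same-colour-gap distinct-gap u≢v w@(cons _ (cons _ nil)) =
    s≤s (s≤s (same-colour-gap u≢v (sym (walk-colour w))))
  radio-diameter-4 c adjacent-gap same-colour-gap distinct-gap {u} {v} u≢v
                   {suc (suc (suc k))} (cons _ (cons _ (cons _ _))) =
    s≤s (s≤s (s≤s (≤-trans (distinct-gap u≢v) (m≤n+m ∣ c u - c v ∣ k))))

-- The permutation σ of {0, …, 13 + X}, X = 2m (the cycle C_{2n}, n = 7 + m)

-- σ-tail i = σ(6 + i): even i ↦ i + 1, odd i ↦ i + 5.  The lemmas below give
-- these closed forms, its parity reversal, and gaps between neighbours.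
σ-tail : ℕ → ℕ
σ-tail 0 = 1
σ-tail 1 = 6
σ-tail (suc (suc i)) = 2 + σ-tail i

σ-tail-parity : ∀ i → parity (σ-tail i) ≡ not (parity i)
σ-tail-parity 0 = refl
σ-tail-parity 1 = refl
σ-tail-parity (suc (suc i)) =
  trans (parity-2+ (σ-tail i)) (trans (σ-tail-parity i) (cong not (sym (parity-2+ i))))

σ-tail-odd : ∀ i → parity i ≡ true → σ-tail i ≡ 5 + i
σ-tail-odd 1 _ = refl
σ-tail-odd (suc (suc i)) e =
  cong (2 +_) (σ-tail-odd i (trans (sym (parity-2+ i)) e))

σ-tail-even : ∀ i → parity i ≡ false → σ-tail i ≡ suc i
σ-tail-even 0 _ = refl
σ-tail-even (suc (suc i)) e =
  cong (2 +_) (σ-tail-even i (trans (sym (parity-2+ i)) e))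

σ-tail-bound : ∀ i → σ-tail i ≤ 5 + i
σ-tail-bound 0 = s≤s z≤n
σ-tail-bound 1 = ≤-refl
σ-tail-bound (suc (suc i)) = s≤s (s≤s (σ-tail-bound i))

σ-tail-gap : ∀ i → ∣ σ-tail i - σ-tail (suc i) ∣ ≢ 1
σ-tail-gap 0 ()
σ-tail-gap 1 ()
σ-tail-gap (suc (suc i)) = σ-tail-gap i

module Permutation (m : ℕ) where

  X : ℕ
  X = double m

  -- σ(i) = i - 1 for odd i and σ(i) = i - 5 (mod 14 + X) for even i.
  σ : ℕ → ℕ
  σ 0 = 9 + X
  σ 1 = 0
  σ 2 = 11 + X
  σ 3 = 2
  σ 4 = 13 + X
  σ 5 = 4
  σ (suc (suc (suc (suc (suc (suc i)))))) = σ-tail i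

  σ-parity : ∀ i → parity (σ i) ≡ not (parity i)
  σ-parity 0 rewrite parity-double m = refl
  σ-parity 1 = refl
  σ-parity 2 rewrite parity-double m = refl
  σ-parity 3 = refl
  σ-parity 4 rewrite parity-double m = refl
  σ-parity 5 = refl
  σ-parity (suc (suc (suc (suc (suc (suc i)))))) =
    trans (σ-tail-parity i) (cong not (sym (parity-6+ i)))

  σ-odd : ∀ i → parity i ≡ true → suc (σ i) ≡ i
  σ-odd 1 _ = refl
  σ-odd 3 _ = refl
  σ-odd 5 _ = refl
  σ-odd (suc (suc (suc (suc (suc (suc i)))))) e =
    cong suc (σ-tail-odd i (trans (sym (parity-6+ i)) e))

  σ-even : ∀ i → parity i ≡ false → 5 + σ i ≡ i ⊎ 5 + σ i ≡ i + (14 + X)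
  σ-even 0 _ = inj₂ refl
  σ-even 2 _ = inj₂ refl
  σ-even 4 _ = inj₂ refl
  σ-even (suc (suc (suc (suc (suc (suc i)))))) e =
    inj₁ (cong (5 +_) (σ-tail-even i (trans (sym (parity-6+ i)) e)))

  no-wrap : ∀ {a b} → a < 14 + X → a ≢ b + (14 + X)
  no-wrap {b = b} a< refl = <⇒≱ a< (m≤n+m (14 + X) b)

  σ-even-injective : ∀ {i j} → i < 14 + X → j < 14 + X →
    parity i ≡ false → parity j ≡ false → σ i ≡ σ j → i ≡ j
  σ-even-injective {i} {j} i< j< pi pj eq with σ-even i pi | σ-even j pj | cong (5 +_) eq
  ... | inj₁ ei | inj₁ ej | e = trans (sym ei) (trans e ej)
  ... | inj₂ ei | inj₂ ej | e = +-cancelʳ-≡ (14 + X) i j (trans (sym ei) (trans e ej))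
  ... | inj₁ ei | inj₂ ej | e = ⊥-elim (no-wrap i< (trans (sym ei) (trans e ej)))
  ... | inj₂ ei | inj₁ ej | e = ⊥-elim (no-wrap j< (trans (sym ej) (trans (sym e) ei)))

  σ-injective : ∀ {i j} → i < 14 + X → j < 14 + X → σ i ≡ σ j → i ≡ j
  σ-injective {i} {j} i< j< eq = by-parity (parity i) refl
    where
    same-parity : parity j ≡ parity i
    same-parity = not-injective
      (trans (sym (σ-parity j)) (trans (cong parity (sym eq)) (σ-parity i)))

    by-parity : ∀ b → parity i ≡ b → i ≡ j
    by-parity true pi =
      trans (sym (σ-odd i pi)) (trans (cong suc eq) (σ-odd j (trans same-parity pi)))
    by-parity false pi = σ-even-injective i< j< pi (trans same-parity pi) eq

  σ-consecutive-gap : ∀ a → ∣ σ a - σ (suc a) ∣ ≢ 1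
  σ-consecutive-gap 0 ()
  σ-consecutive-gap 1 ()
  σ-consecutive-gap 2 ()
  σ-consecutive-gap 3 ()
  σ-consecutive-gap 4 ()
  σ-consecutive-gap 5 ()
  σ-consecutive-gap (suc (suc (suc (suc (suc (suc i)))))) = σ-tail-gap i

  σ-wrap-gap : ∣ σ 0 - σ (13 + X) ∣ ≢ 1
  σ-wrap-gap e = 3≢1 (trans (sym wrap-gap) e)
    where
    3≢1 : 3 ≢ 1
    3≢1 ()

    odd : parity (7 + X) ≡ true
    odd rewrite parity-double m = refl

    gap-three : ∀ y → ∣ y - 3 + y ∣ ≡ 3
    gap-three zero = refl
    gap-three (suc y) = gap-three y

    wrap-gap : ∣ σ 0 - σ (13 + X) ∣ ≡ 3
    wrap-gap = begin
      ∣ 9 + X - σ-tail (7 + X) ∣  ≡⟨ cong (λ y → ∣ 9 + X - y ∣) (σ-tail-odd (7 + X) odd) ⟩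
      ∣ 9 + X - 12 + X ∣          ≡⟨ gap-three X ⟩
      3                           ∎
      where open ≡-Reasoning

  σ-bound : ∀ i → i < 14 + X → σ i ≤ 13 + X
  σ-bound 0 _ = +-monoˡ-≤ X (m≤m+n 9 4)
  σ-bound 1 _ = z≤n
  σ-bound 2 _ = +-monoˡ-≤ X (m≤m+n 11 2)
  σ-bound 3 _ = s≤s (s≤s z≤n)
  σ-bound 4 _ = ≤-refl
  σ-bound 5 _ = s≤s (s≤s (s≤s (s≤s z≤n)))
  σ-bound (suc (suc (suc (suc (suc (suc i)))))) (s≤s (s≤s (s≤s (s≤s (s≤s (s≤s (s≤s i≤)))))))
    = ≤-trans (σ-tail-bound i) (s≤s (s≤s (s≤s (s≤s (s≤s (m≤n⇒m≤1+n i≤))))))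

-- The gear G_n for n = 7 + m

-- The largest σ-value 13 + 2m gives the span 4n + 2.
span : ∀ m → 4 + 2 * (13 + 2 * m) ≡ 4 * (7 + m) + 2
span = solve-∀

-- Cycle labels differ by twice their σ-gap g, and the centre's label differs
-- from a cycle label by 3 + 2s, s the σ-value; these turn into label gaps.
double-gap≥2 : ∀ {g} → g ≢ 0 → 2 ≤ 2 * g
double-gap≥2 {zero} g≢0 = ⊥-elim (g≢0 refl)
double-gap≥2 {suc g} _ = *-monoʳ-≤ 2 (s≤s z≤n)

double-gap≥4 : ∀ {g} → g ≢ 0 → g ≢ 1 → 4 ≤ 2 * g
double-gap≥4 {zero} g≢0 _ = ⊥-elim (g≢0 refl)
double-gap≥4 {suc zero} _ g≢1 = ⊥-elim (g≢1 refl)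
double-gap≥4 {suc (suc g)} _ _ = *-monoʳ-≤ 2 (s≤s (s≤s z≤n))

spoke-gap≥4 : ∀ {s} → s ≢ 0 → 4 ≤ 3 + 2 * s
spoke-gap≥4 {zero} s≢0 = ⊥-elim (s≢0 refl)
spoke-gap≥4 {suc s} _ = s≤s (s≤s (s≤s (s≤s z≤n)))

module Gear (m : ℕ) where
  open Permutation m

  n : ℕ
  n = 7 + m

  V : Set
  V = Fin (suc (2 * n))

  Adj : V → V → Set
  Adj = GearAdj n

  position< : (i : Fin (2 * n)) → toℕ i < 14 + X
  position< i = subst (toℕ i <_) (2*≡double n) (Fin.toℕ<n i)

  -- Gear adjacency is decidable, so distances can be computed from walks.
  adj? : ∀ u v → Dec (Adj u v)
  adj? fzero fzero = no λ ()
  adj? fzero (fsuc j) = even? (toℕ j)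
  adj? (fsuc i) fzero = even? (toℕ i)
  adj? (fsuc i) (fsuc j) =
    (suc a ≟ b) ⊎-dec ((suc b ≟ a) ⊎-dec
      (((a ≟ 0) ×-dec (suc b ≟ 2 * n)) ⊎-dec ((b ≟ 0) ×-dec (suc a ≟ 2 * n))))
    where
    a b : ℕ
    a = toℕ i
    b = toℕ j

  open DecidableGraph adj?

  colour : V → Bool
  colour fzero = true
  colour (fsuc i) = parity (toℕ i)

  -- Neighbours on the cycle C_{2n} (2n even) have opposite parities.
  cycle-parity : ∀ {a b} → CycleAdj n a b → parity b ≡ not (parity a)
  cycle-parity (inj₁ refl) = refl
  cycle-parity (inj₂ (inj₁ refl)) = sym (not-involutive _)
  cycle-parity (inj₂ (inj₂ (inj₁ (refl , e)))) =
    not-injective (trans (cong parity e) (parity-2* n refl))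
  cycle-parity (inj₂ (inj₂ (inj₂ (refl , e)))) =
    sym (trans (cong parity e) (parity-2* n refl))

  proper : ∀ {u v} → Adj u v → colour v ≡ not (colour u)
  proper {fzero} {fzero} ()
  proper {fzero} {fsuc j} (k , e) = parity-2* k e
  proper {fsuc i} {fzero} (k , e) = cong not (sym (parity-2* k e))
  proper {fsuc i} {fsuc j} a = cycle-parity a

  open TwoColoured {Adj = Adj} colour proper

  -- Every cycle vertex is joined to the centre by walks of length ≤ 2 in
  -- both directions: directly if its index is even, else via its predecessor.
  hub-walks : ∀ i → Σ ℕ λ k → k ≤ 2 × Walk Adj (fsuc i) fzero k × Walk Adj fzero (fsuc i) k
  hub-walks i with parity (toℕ i) in e
  ... | false = 1 , s≤s z≤n , cons spoke nil , cons spoke nil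
    where
    spoke : Σ ℕ λ k → toℕ i ≡ 2 * k
    spoke = parity-even (toℕ i) e
  ... | true with parity-odd (toℕ i) e
  ... | h , i≡1+2h =
    2 , ≤-refl , cons {w = j} (inj₂ (inj₁ j+1≡i)) (cons spoke nil)
               , cons spoke (cons (inj₁ j+1≡i) nil)
    where
    2h<2n : 2 * h < 2 * n
    2h<2n = <-trans (n<1+n (2 * h)) (subst (_< 2 * n) i≡1+2h (Fin.toℕ<n i))

    j : V
    j = fsuc (fromℕ< 2h<2n)

    spoke : Σ ℕ λ k → toℕ (fromℕ< 2h<2n) ≡ 2 * k
    spoke = h , Fin.toℕ-fromℕ< 2h<2n

    j+1≡i : suc (toℕ (fromℕ< 2h<2n)) ≡ toℕ i
    j+1≡i = trans (cong suc (Fin.toℕ-fromℕ< 2h<2n)) (sym i≡1+2h)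

  short-walk : ∀ u v → Σ ℕ λ L → L ≤ 4 × Walk Adj u v L
  short-walk fzero fzero = 0 , z≤n , nil
  short-walk fzero (fsuc j) with hub-walks j
  ... | k , k≤2 , _ , w = k , ≤-trans k≤2 (m≤m+n 2 2) , w
  short-walk (fsuc i) fzero with hub-walks i
  ... | k , k≤2 , w , _ = k , ≤-trans k≤2 (m≤m+n 2 2) , w
  short-walk (fsuc i) (fsuc j) with hub-walks i | hub-walks j
  ... | k , k≤2 , w , _ | l , l≤2 , _ , w′ = k + l , +-mono-≤ k≤2 l≤2 , (w ++ʷ w′)

  distances : ∀ u v → Σ ℕ λ k → IsDist Adj u v k × k ≤ 4
  distances u v with short-walk u v
  ... | L , L≤4 , w = distance≤ 4 L≤4 w

  cycle-neighbour-of-1 : ∀ {x} → CycleAdj n 1 x → x ≤ 2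
  cycle-neighbour-of-1 (inj₁ refl) = ≤-refl
  cycle-neighbour-of-1 (inj₂ (inj₁ refl)) = z≤n
  cycle-neighbour-of-1 (inj₂ (inj₂ (inj₁ (() , _))))
  cycle-neighbour-of-1 (inj₂ (inj₂ (inj₂ (refl , _)))) = z≤n

  cycle-neighbour-of-5 : ∀ {x} → CycleAdj n x 5 → 4 ≤ x
  cycle-neighbour-of-5 (inj₁ refl) = ≤-refl
  cycle-neighbour-of-5 (inj₂ (inj₁ refl)) = s≤s (s≤s (s≤s (s≤s z≤n)))
  cycle-neighbour-of-5 (inj₂ (inj₂ (inj₁ (refl , ()))))
  cycle-neighbour-of-5 (inj₂ (inj₂ (inj₂ (() , _))))

  position-1 position-5 : V
  position-1 = fsuc (fsuc fzero)
  position-5 = fsuc (fsuc (fsuc (fsuc (fsuc (fsuc fzero)))))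

  -- The walk 1, 0, centre, 4, 5 is shortest: walks of odd length change the
  -- colour, and a walk of length 2 would need a common neighbour.
  far-pair : IsDist Adj position-1 position-5 4
  far-pair = walk , shortest
    where
    walk : Walk Adj position-1 position-5 4
    walk = cons {w = fsuc fzero} (inj₂ (inj₁ refl))
             (cons {w = fzero} (0 , refl)
             (cons {w = fsuc (fsuc (fsuc (fsuc (fsuc fzero))))} (2 , refl)
             (cons (inj₁ refl) nil)))

    shortest : ∀ k → Walk Adj position-1 position-5 k → 4 ≤ k
    shortest _ w@(cons _ nil) with walk-colour w
    ... | ()
    shortest _ (cons {w = fzero} (k , 1≡2k) (cons _ nil)) = ⊥-elim (not-¬ refl (parity-2* k 1≡2k))
    shortest _ (cons {w = fsuc x} a (cons b nil)) =
      ⊥-elim (4≰2 (≤-trans (cycle-neighbour-of-5 b) (cycle-neighbour-of-1 a)))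
      where
      4≰2 : ¬ 4 ≤ 2
      4≰2 (s≤s (s≤s ()))
    shortest _ w@(cons _ (cons _ (cons _ nil))) with walk-colour w
    ... | ()
    shortest _ (cons _ (cons _ (cons _ (cons _ _)))) = s≤s (s≤s (s≤s (s≤s z≤n)))

  diameter : IsDiam Adj 4
  diameter = distances , position-1 , position-5 , far-pair

  label : V → ℕ
  label fzero = 1
  label (fsuc i) = 4 + 2 * σ (toℕ i)

  cycle-label-gap : ∀ i j → ∣ label (fsuc i) - label (fsuc j) ∣ ≡ 2 * ∣ σ (toℕ i) - σ (toℕ j) ∣
  cycle-label-gap i j = sym (*-distribˡ-∣-∣ 2 (σ (toℕ i)) (σ (toℕ j)))

  σ-gap≢0 : ∀ {i j} → fsuc {2 * n} i ≢ fsuc j → ∣ σ (toℕ i) - σ (toℕ j) ∣ ≢ 0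
  σ-gap≢0 {i} {j} i≢j gap≡0 =
    i≢j (cong fsuc (Fin.toℕ-injective (σ-injective (position< i) (position< j) (∣m-n∣≡0⇒m≡n gap≡0))))

  -- Positions of equal parity have σ-values of equal parity, never 1 apart.
  σ-same-parity-gap : ∀ {a b} → parity a ≡ parity b → ∣ σ a - σ b ∣ ≢ 1
  σ-same-parity-gap {a} {b} pa≡pb gap≡1 = not-¬ pa≡pb (not-injective (begin
    not (parity a)       ≡⟨ σ-parity a ⟨
    parity (σ a)         ≡⟨ gap-one-parity (σ a) (σ b) gap≡1 ⟩
    not (parity (σ b))   ≡⟨ cong not (σ-parity b) ⟩
    not (not (parity b)) ∎))
    where open ≡-Reasoning

  last-position : ∀ {b} → suc b ≡ 2 * n → b ≡ 13 + X
  last-position e = suc-injective (trans e (2*≡double n))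

  σ-cycle-gap : ∀ {a b} → CycleAdj n a b → ∣ σ a - σ b ∣ ≢ 1
  σ-cycle-gap {a} (inj₁ refl) = σ-consecutive-gap a
  σ-cycle-gap {b = b} (inj₂ (inj₁ refl)) = σ-consecutive-gap b ∘ trans (∣-∣-comm (σ b) (σ (suc b)))
  σ-cycle-gap (inj₂ (inj₂ (inj₁ (refl , e)))) =
    σ-wrap-gap ∘ subst (λ x → ∣ σ 0 - σ x ∣ ≡ 1) (last-position e)
  σ-cycle-gap {a} (inj₂ (inj₂ (inj₂ (refl , e)))) =
    σ-wrap-gap ∘ subst (λ x → ∣ σ 0 - σ x ∣ ≡ 1) (last-position e) ∘ trans (∣-∣-comm (σ 0) (σ a))

  -- σ-value 0 belongs to the odd position 1, so spoke endpoints have σ ≢ 0.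
  spoke-σ≢0 : ∀ {i k} → i ≡ 2 * k → σ i ≢ 0
  spoke-σ≢0 {i} {k} i≡2k σi≡0 = not-¬ refl (begin
    false            ≡⟨ cong parity σi≡0 ⟨
    parity (σ i)     ≡⟨ σ-parity i ⟩
    not (parity i)   ≡⟨ cong not (parity-2* k i≡2k) ⟩
    true             ∎)
    where open ≡-Reasoning

  adjacent-gap : ∀ {u v} → u ≢ v → Adj u v → 4 ≤ ∣ label u - label v ∣
  adjacent-gap {fzero} {fsuc j} _ (k , e) = spoke-gap≥4 (spoke-σ≢0 {k = k} e)
  adjacent-gap {fsuc i} {fzero} _ (k , e) = spoke-gap≥4 (spoke-σ≢0 {k = k} e)
  adjacent-gap {fsuc i} {fsuc j} u≢v a rewrite cycle-label-gap i j =
    double-gap≥4 (σ-gap≢0 u≢v) (σ-cycle-gap a)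

  same-colour-gap : ∀ {u v} → u ≢ v → colour u ≡ colour v → 3 ≤ ∣ label u - label v ∣
  same-colour-gap {fzero} {fzero} u≢v _ = ⊥-elim (u≢v refl)
  same-colour-gap {fzero} {fsuc j} _ _ = s≤s (s≤s (s≤s z≤n))
  same-colour-gap {fsuc i} {fzero} _ _ = s≤s (s≤s (s≤s z≤n))
  same-colour-gap {fsuc i} {fsuc j} u≢v same rewrite cycle-label-gap i j =
    ≤-trans (n≤1+n 3) (double-gap≥4 (σ-gap≢0 u≢v) (σ-same-parity-gap {toℕ i} {toℕ j} same))

  distinct-gap : ∀ {u v} → u ≢ v → 2 ≤ ∣ label u - label v ∣
  distinct-gap {fzero} {fzero} u≢v = ⊥-elim (u≢v refl)
  distinct-gap {fzero} {fsuc j} _ = s≤s (s≤s z≤n)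
  distinct-gap {fsuc i} {fzero} _ = s≤s (s≤s z≤n)
  distinct-gap {fsuc i} {fsuc j} u≢v rewrite cycle-label-gap i j = double-gap≥2 (σ-gap≢0 u≢v)

  positive : ∀ v → 1 ≤ label v
  positive fzero = s≤s z≤n
  positive (fsuc i) = s≤s z≤n

  label-bound : ∀ v → label v ≤ 4 * n + 2
  label-bound fzero = s≤s z≤n
  label-bound (fsuc i) = begin
    4 + 2 * σ (toℕ i)     ≤⟨ +-monoʳ-≤ 4 (*-monoʳ-≤ 2 (σ-bound (toℕ i) (position< i))) ⟩
    4 + 2 * (13 + X)      ≡⟨ cong (λ x → 4 + 2 * (13 + x)) (2*≡double m) ⟨
    4 + 2 * (13 + 2 * m)  ≡⟨ span m ⟩
    4 * n + 2             ∎
    where open ≤-Reasoning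

  radio-number-bound : RadioNumberAtMost Adj (4 * n + 2)
  radio-number-bound =
    4 , diameter , label ,
    radio-from-walks label distances positive
      (radio-diameter-4 label adjacent-gap same-colour-gap distinct-gap) ,
    label-bound

theorem2p2 : (n : ℕ) → 7 ≤ n → RadioNumberAtMost (GearAdj n) (4 * n + 2)
theorem2p2 n 7≤n with m≤n⇒∃[o]m+o≡n 7≤n
... | m , refl = Gear.radio-number-bound m
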